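{- Let $S$ be a set and let $\mathcal C=F^{\mathrm{LD}}_S$ be the free LD category on $S$. If $Y',Y''\in\mathcal C$ are thin, then so is $Y'\odot Y''$.
   Context: The free (unitless) LD category $F^{\mathrm{LD}}_S$ on $S$: objects are formal binary expressions built from elements of $S$ with two operations $\otimes,\odot$. Morphisms are generated by identities and components of $\alpha_{A,B,C}:A\otimes(B\otimes C)\to(A\otimes B)\otimes C$, $\alpha^{ -1}$, $\bar\alpha_{A,B,C}:A\odot(B\odot C)\to(A\odot B)\odot C$, $\bar\alpha^{ -1}$, $\delta^l_{A,B,C}:A\otimes(B\odot C)\to(A\otimes B)\odot C$, $\delta^r_{A,B,C}:(A\odot B)\otimes C\to A\odot(B\otimes C)$ under composition, $\otimes$, $\odot$, modulo exactly the relations making it a category with bifunctors $\otimes,\odot$, natural $\alpha,\bar\alpha,\delta^l,\delta^r$, $\alpha^{\pm1}$ and $\bar\alpha^{\pm1}$ mutually inverse, and the pentagon axioms (objects denote identities): (P1) $\alpha_{A\otimes B,C,D}\circ\alpha_{A,B,C\otimes D}=(\alpha_{A,B,C}\otimes D)\circ\alpha_{A,B\otimes C,D}\circ(A\otimes\alpha_{B,C,D})$; (P2) $\delta^l_{A\otimes B,C,D}\circ\alpha_{A,B,C\odot D}=(\alpha_{A,B,C}\odot D)\circ\delta^l_{A,B\otimes C,D}\circ(A\otimes\delta^l_{B,C,D})$; (P3) $\delta^l_{A,B,C\otimes D}\circ(A\otimes\delta^r_{B,C,D})=\delta^r_{A\otimes B,C,D}\circ(\delta^l_{A,B,C}\otimes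 D)\circ\alpha_{A,B\odot C,D}$; (P4) $\bar\alpha_{A\otimes B,C,D}\circ\delta^l_{A,B,C\odot D}=(\delta^l_{A,B,C}\odot D)\circ\delta^l_{A,B\odot C,D}\circ(A\otimes\bar\alpha_{B,C,D})$; (P5) $(A\odot\alpha_{B,C,D})\circ\delta^r_{A,B,C\otimes D}=\delta^r_{A,B\otimes C,D}\circ(\delta^r_{A,B,C}\otimes D)\circ\alpha_{A\odot B,C,D}$; (P6) $(\delta^r_{A,B,C}\odot D)\circ\delta^l_{A\odot B,C,D}=\bar\alpha_{A,B\otimes C,D}\circ(A\odot\delta^l_{B,C,D})\circ\delta^r_{A,B,C\odot D}$; (P7) $\delta^r_{A\odot B,C,D}\circ(\bar\alpha_{A,B,C}\otimes D)=\bar\alpha_{A,B,C\otimes D}\circ(A\odot\delta^r_{B,C,D})\circ\delta^r_{A,B\odot C,D}$; (P8) $\bar\alpha_{A\odot B,C,D}\circ\bar\alpha_{A,B,C\odot D}=(\bar\alpha_{A,B,C}\odot D)\circ\bar\alpha_{A,B\odot C,D}\circ(A\odot\bar\alpha_{B,C,D})$. An object $Y$ is thin if for every object $X$ there is at most one morphism $X\to Y$. -}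

module Defs where

-- The free (unitless) LD category F^LD_S on a set S, presented by
-- generators and relations: morphisms are formal terms (Hom) and the
-- morphism equality is the least congruence (_≈_) generated by the listed
-- relations.  Since Agda has no quotient types, "at most one morphism X → Y"
-- is rendered as: any two morphism terms X → Y are related by _≈_.

module _ (S : Set) where

  infixr 7 _⊗_ _⊙_

  data Obj : Set where
    var : S → Obj
    _⊗_ : Obj → Obj → Obj
    _⊙_ : Obj → Obj → Obj

  infixr 9 _∘_
  infixr 8 _⊗₁_ _⊙₁_

  data Hom : Obj → Obj → Set where
    id    : (A : Obj) → Hom A A
    _∘_   : ∀ {A B C} → Hom B C → Hom A B → Hom A C
    _⊗₁_  : ∀ {A B C D} → Hom A B → Hom C D → Hom (A ⊗ C) (B ⊗ D)
    _⊙₁_  : ∀ {A B C D} → Hom A B → Hom C D → Hom (A ⊙ C) (B ⊙ D)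
    α     : (A B C : Obj) → Hom (A ⊗ (B ⊗ C)) ((A ⊗ B) ⊗ C)
    α⁻¹   : (A B C : Obj) → Hom ((A ⊗ B) ⊗ C) (A ⊗ (B ⊗ C))
    ᾱ     : (A B C : Obj) → Hom (A ⊙ (B ⊙ C)) ((A ⊙ B) ⊙ C)
    ᾱ⁻¹   : (A B C : Obj) → Hom ((A ⊙ B) ⊙ C) (A ⊙ (B ⊙ C))
    δl    : (A B C : Obj) → Hom (A ⊗ (B ⊙ C)) ((A ⊗ B) ⊙ C)
    δr    : (A B C : Obj) → Hom ((A ⊙ B) ⊗ C) (A ⊙ (B ⊗ C))

  infix 4 _≈_

  data _≈_ : ∀ {X Y} → Hom X Y → Hom X Y → Set where
    ≈-refl  : ∀ {X Y} {f : Hom X Y} → f ≈ f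
    ≈-sym   : ∀ {X Y} {f g : Hom X Y} → f ≈ g → g ≈ f
    ≈-trans : ∀ {X Y} {f g h : Hom X Y} → f ≈ g → g ≈ h → f ≈ h
    ∘-cong  : ∀ {X Y Z} {f f' : Hom Y Z} {g g' : Hom X Y} →
              f ≈ f' → g ≈ g' → f ∘ g ≈ f' ∘ g'
    ⊗-cong  : ∀ {A B C D} {f f' : Hom A B} {g g' : Hom C D} →
              f ≈ f' → g ≈ g' → f ⊗₁ g ≈ f' ⊗₁ g'
    ⊙-cong  : ∀ {A B C D} {f f' : Hom A B} {g g' : Hom C D} →
              f ≈ f' → g ≈ g' → f ⊙₁ g ≈ f' ⊙₁ g'
    idˡ     : ∀ {X Y} {f : Hom X Y} → id Y ∘ f ≈ f
    idʳ     : ∀ {X Y} {f : Hom X Y} → f ∘ id X ≈ f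
    assoc   : ∀ {W X Y Z} {f : Hom Y Z} {g : Hom X Y} {h : Hom W X} →
              (f ∘ g) ∘ h ≈ f ∘ (g ∘ h)
    ⊗-id    : ∀ {A B} → id A ⊗₁ id B ≈ id (A ⊗ B)
    ⊗-∘     : ∀ {A B C D E F} {f : Hom B C} {g : Hom A B} {h : Hom E F} {k : Hom D E} →
              (f ∘ g) ⊗₁ (h ∘ k) ≈ (f ⊗₁ h) ∘ (g ⊗₁ k)
    ⊙-id    : ∀ {A B} → id A ⊙₁ id B ≈ id (A ⊙ B)
    ⊙-∘     : ∀ {A B C D E F} {f : Hom B C} {g : Hom A B} {h : Hom E F} {k : Hom D E} →
              (f ∘ g) ⊙₁ (h ∘ k) ≈ (f ⊙₁ h) ∘ (g ⊙₁ k)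
    α-nat   : ∀ {A A' B B' C C'} {f : Hom A A'} {g : Hom B B'} {h : Hom C C'} →
              α A' B' C' ∘ (f ⊗₁ (g ⊗₁ h)) ≈ ((f ⊗₁ g) ⊗₁ h) ∘ α A B C
    ᾱ-nat   : ∀ {A A' B B' C C'} {f : Hom A A'} {g : Hom B B'} {h : Hom C C'} →
              ᾱ A' B' C' ∘ (f ⊙₁ (g ⊙₁ h)) ≈ ((f ⊙₁ g) ⊙₁ h) ∘ ᾱ A B C
    δl-nat  : ∀ {A A' B B' C C'} {f : Hom A A'} {g : Hom B B'} {h : Hom C C'} →
              δl A' B' C' ∘ (f ⊗₁ (g ⊙₁ h)) ≈ ((f ⊗₁ g) ⊙₁ h) ∘ δl A B C
    δr-nat  : ∀ {A A' B B' C C'} {f : Hom A A'} {g : Hom B B'} {h : Hom C C'} →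
              δr A' B' C' ∘ ((f ⊙₁ g) ⊗₁ h) ≈ (f ⊙₁ (g ⊗₁ h)) ∘ δr A B C
    α-inv₁  : ∀ {A B C} → α⁻¹ A B C ∘ α A B C ≈ id (A ⊗ (B ⊗ C))
    α-inv₂  : ∀ {A B C} → α A B C ∘ α⁻¹ A B C ≈ id ((A ⊗ B) ⊗ C)
    ᾱ-inv₁  : ∀ {A B C} → ᾱ⁻¹ A B C ∘ ᾱ A B C ≈ id (A ⊙ (B ⊙ C))
    ᾱ-inv₂  : ∀ {A B C} → ᾱ A B C ∘ ᾱ⁻¹ A B C ≈ id ((A ⊙ B) ⊙ C)
    P1 : ∀ {A B C D} →
         α (A ⊗ B) C D ∘ α A B (C ⊗ D)
           ≈ (α A B C ⊗₁ id D) ∘ α A (B ⊗ C) D ∘ (id A ⊗₁ α B C D)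
    P2 : ∀ {A B C D} →
         δl (A ⊗ B) C D ∘ α A B (C ⊙ D)
           ≈ (α A B C ⊙₁ id D) ∘ δl A (B ⊗ C) D ∘ (id A ⊗₁ δl B C D)
    P3 : ∀ {A B C D} →
         δl A B (C ⊗ D) ∘ (id A ⊗₁ δr B C D)
           ≈ δr (A ⊗ B) C D ∘ (δl A B C ⊗₁ id D) ∘ α A (B ⊙ C) D
    P4 : ∀ {A B C D} →
         ᾱ (A ⊗ B) C D ∘ δl A B (C ⊙ D)
           ≈ (δl A B C ⊙₁ id D) ∘ δl A (B ⊙ C) D ∘ (id A ⊗₁ ᾱ B C D)
    P5 : ∀ {A B C D} →
         (id A ⊙₁ α B C D) ∘ δr A B (C ⊗ D)
           ≈ δr A (B ⊗ C) D ∘ (δr A B C ⊗₁ id D) ∘ α (A ⊙ B) C D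
    P6 : ∀ {A B C D} →
         (δr A B C ⊙₁ id D) ∘ δl (A ⊙ B) C D
           ≈ ᾱ A (B ⊗ C) D ∘ (id A ⊙₁ δl B C D) ∘ δr A B (C ⊙ D)
    P7 : ∀ {A B C D} →
         δr (A ⊙ B) C D ∘ (ᾱ A B C ⊗₁ id D)
           ≈ ᾱ A B (C ⊗ D) ∘ (id A ⊙₁ δr B C D) ∘ δr A (B ⊙ C) D
    P8 : ∀ {A B C D} →
         ᾱ (A ⊙ B) C D ∘ ᾱ A B (C ⊙ D)
           ≈ (ᾱ A B C ⊙₁ id D) ∘ ᾱ A (B ⊙ C) D ∘ (id A ⊙₁ ᾱ B C D)

  Thin : Obj → Set
  Thin Y = ∀ (X : Obj) (f g : Hom X Y) → f ≈ g

{-# OPTIONS --safe #-}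

-- A ⊙-node of an object X, reached from the root through ⊗ and ⊙ (a Split X L R), can be
-- rotated to the root by δl, δr and ᾱ^{±1}; this gives expose : X → L ⊙ R, where L and R
-- collect the leaves of X to the left and to the right of that node.  Every morphism
-- f : X → Z pulls each split p of Z back to a split q of X along which it decomposes,
-- expose p ∘ f ≈ (f_L ⊙ f_R) ∘ expose q; for the generators this is one naturality square or
-- one of the pentagons P2–P8.  For f, g : X → Y' ⊙ Y'' the splits
-- pulled back from the root have left parts with as many leaves as Y', so they coincide, and
-- thinness of Y' and Y'' identifies the two decompositions.

module Submission where

open import Data.Empty using (⊥-elim)
open import Data.Nat using (ℕ; _+_; _<_; z<s)
open import Data.Nat.Properties
  using (+-assoc; +-cancelˡ-≡; m<m+n; m≤m+n; +-monoʳ-<; <-≤-trans; <-trans; <⇒≢; >⇒≢)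
open import Data.Product using (Σ-syntax; _,_)
open import Level using (0ℓ)
open import Relation.Binary.Bundles using (Setoid)
open import Relation.Binary.PropositionalEquality as ≡ using (_≡_; refl; cong₂)
import Relation.Binary.Reasoning.Setoid as SetoidReasoning

open import Defs hiding (_≈_)

module FreeLDCategory (S : Set) where

  infix 4 _≈_
  _≈_ : {X Y : Obj S} → Hom S X Y → Hom S X Y → Set
  f ≈ g = Defs._≈_ S f g

  hom-setoid : Obj S → Obj S → Setoid 0ℓ 0ℓ
  hom-setoid X Y = record
    { Carrier       = Hom S X Y
    ; _≈_           = _≈_
    ; isEquivalence = record { refl = ≈-refl ; sym = ≈-sym ; trans = ≈-trans }
    }

  module HomReasoning {X Y : Obj S} = SetoidReasoning (hom-setoid X Y)
  open HomReasoning

  private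
    variable
      A B C D A' B' L R L' R' W X Y Z : Obj S

  infixr 4 refl⟩∘⟨_
  infixl 5 _⟩∘⟨refl

  refl⟩∘⟨_ : {f : Hom S Y Z} {g g' : Hom S X Y} → g ≈ g' → f ∘ g ≈ f ∘ g'
  refl⟩∘⟨_ = ∘-cong ≈-refl

  _⟩∘⟨refl : {f f' : Hom S Y Z} {g : Hom S X Y} → f ≈ f' → f ∘ g ≈ f' ∘ g
  p ⟩∘⟨refl = ∘-cong p ≈-refl

  sym-assoc : {f : Hom S Y Z} {g : Hom S X Y} {h : Hom S W X} → f ∘ (g ∘ h) ≈ (f ∘ g) ∘ h
  sym-assoc = ≈-sym assoc

  pullˡ : {a : Hom S Y Z} {b : Hom S X Y} {c : Hom S X Z} {f : Hom S W X} →
          a ∘ b ≈ c → a ∘ b ∘ f ≈ c ∘ f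
  pullˡ {a = a} {b} {c} {f} ab≈c = begin
    a ∘ b ∘ f    ≈⟨ sym-assoc ⟩
    (a ∘ b) ∘ f  ≈⟨ ab≈c ⟩∘⟨refl ⟩
    c ∘ f        ∎

  pushˡ : {a : Hom S Y Z} {b : Hom S X Y} {c : Hom S X Z} {f : Hom S W X} →
          c ≈ a ∘ b → c ∘ f ≈ a ∘ b ∘ f
  pushˡ c≈ab = ≈-sym (pullˡ (≈-sym c≈ab))

  cancelˡ : {a : Hom S Y X} {b : Hom S X Y} {f : Hom S W X} → a ∘ b ≈ id X → a ∘ b ∘ f ≈ f
  cancelˡ ab≈id = ≈-trans (pullˡ ab≈id) idˡ

  extendʳ : {a : Hom S Y Z} {b : Hom S X Y} {c : Hom S A Z} {d : Hom S X A} {f : Hom S W X} →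
            a ∘ b ≈ c ∘ d → a ∘ b ∘ f ≈ c ∘ d ∘ f
  extendʳ {a = a} {b} {c} {d} {f} eq = begin
    a ∘ b ∘ f      ≈⟨ pullˡ eq ⟩
    (c ∘ d) ∘ f    ≈⟨ assoc ⟩
    c ∘ d ∘ f      ∎

  extend₂₃ : {a : Hom S Y Z} {b : Hom S X Y} {c : Hom S B Z} {d : Hom S A B} {e : Hom S X A}
             {f : Hom S W X} → a ∘ b ≈ c ∘ d ∘ e → a ∘ b ∘ f ≈ c ∘ d ∘ e ∘ f
  extend₂₃ {a = a} {b} {c} {d} {e} {f} eq = begin
    a ∘ b ∘ f          ≈⟨ pullˡ eq ⟩
    (c ∘ d ∘ e) ∘ f    ≈⟨ assoc ⟩
    c ∘ (d ∘ e) ∘ f    ≈⟨ refl⟩∘⟨ assoc ⟩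
    c ∘ d ∘ e ∘ f      ∎

  extend₃₂ : {a : Hom S B Z} {b : Hom S A B} {c : Hom S X A} {d : Hom S Y Z} {e : Hom S X Y}
             {f : Hom S W X} → a ∘ b ∘ c ≈ d ∘ e → a ∘ b ∘ c ∘ f ≈ d ∘ e ∘ f
  extend₃₂ eq = ≈-sym (extend₂₃ (≈-sym eq))

  move-invˡ : {a : Hom S Y Z} {a' : Hom S Z Y} {x : Hom S X Z} {y : Hom S X Y} →
              a' ∘ a ≈ id Y → x ≈ a ∘ y → a' ∘ x ≈ y
  move-invˡ a'a≈id x≈ay = ≈-trans (refl⟩∘⟨ x≈ay) (cancelˡ a'a≈id)

  conjugate : {a : Hom S Y Z} {a' : Hom S Z Y} {b : Hom S W X} {b' : Hom S X W}
              {x : Hom S W Y} {y : Hom S X Z} →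
              a' ∘ a ≈ id Y → b ∘ b' ≈ id X → a ∘ x ≈ y ∘ b → a' ∘ y ≈ x ∘ b'
  conjugate {a = a} {a'} {b} {b'} {x} {y} a'a≈id bb'≈id ax≈yb = begin
    a' ∘ y                ≈⟨ refl⟩∘⟨ idʳ ⟨
    a' ∘ y ∘ id _         ≈⟨ refl⟩∘⟨ refl⟩∘⟨ bb'≈id ⟨
    a' ∘ y ∘ b ∘ b'       ≈⟨ refl⟩∘⟨ extendʳ ax≈yb ⟨
    a' ∘ a ∘ x ∘ b'       ≈⟨ cancelˡ a'a≈id ⟩
    x ∘ b'                ∎

  id-slide : {g : Hom S X Y} {i : Hom S X X} → i ≈ id X → id Y ∘ g ≈ g ∘ i
  id-slide i≈id = ≈-trans idˡ (≈-trans (≈-sym idʳ) (refl⟩∘⟨ ≈-sym i≈id))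

  ∘⊗id : {f : Hom S Y Z} {g : Hom S X Y} → (f ∘ g) ⊗₁ id C ≈ (f ⊗₁ id C) ∘ (g ⊗₁ id C)
  ∘⊗id = ≈-trans (⊗-cong ≈-refl (≈-sym idˡ)) ⊗-∘

  id⊗∘ : {f : Hom S Y Z} {g : Hom S X Y} → id C ⊗₁ (f ∘ g) ≈ (id C ⊗₁ f) ∘ (id C ⊗₁ g)
  id⊗∘ = ≈-trans (⊗-cong (≈-sym idˡ) ≈-refl) ⊗-∘

  ∘⊙id : {f : Hom S Y Z} {g : Hom S X Y} → (f ∘ g) ⊙₁ id C ≈ (f ⊙₁ id C) ∘ (g ⊙₁ id C)
  ∘⊙id = ≈-trans (⊙-cong ≈-refl (≈-sym idˡ)) ⊙-∘

  id⊙∘ : {f : Hom S Y Z} {g : Hom S X Y} → id C ⊙₁ (f ∘ g) ≈ (id C ⊙₁ f) ∘ (id C ⊙₁ g)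
  id⊙∘ = ≈-trans (⊙-cong (≈-sym idˡ) ≈-refl) ⊙-∘

  ⊗-inverse : {f : Hom S A B} {f' : Hom S B A} {g : Hom S C D} {g' : Hom S D C} →
              f' ∘ f ≈ id A → g' ∘ g ≈ id C → (f' ⊗₁ g') ∘ (f ⊗₁ g) ≈ id (A ⊗ C)
  ⊗-inverse f'f≈id g'g≈id = ≈-trans (≈-sym ⊗-∘) (≈-trans (⊗-cong f'f≈id g'g≈id) ⊗-id)

  ⊙-inverse : {f : Hom S A B} {f' : Hom S B A} {g : Hom S C D} {g' : Hom S D C} →
              f' ∘ f ≈ id A → g' ∘ g ≈ id C → (f' ⊙₁ g') ∘ (f ⊙₁ g) ≈ id (A ⊙ C)
  ⊙-inverse f'f≈id g'g≈id = ≈-trans (≈-sym ⊙-∘) (≈-trans (⊙-cong f'f≈id g'g≈id) ⊙-id)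

  ᾱ⁻¹-nat : {f : Hom S A L} {g : Hom S B R} {h : Hom S C D} →
            ᾱ⁻¹ L R D ∘ ((f ⊙₁ g) ⊙₁ h) ≈ (f ⊙₁ (g ⊙₁ h)) ∘ ᾱ⁻¹ A B C
  ᾱ⁻¹-nat = conjugate ᾱ-inv₁ ᾱ-inv₂ ᾱ-nat

  ᾱ⁻¹-pentagonˡ : ᾱ⁻¹ A (B ⊙ C) D ∘ (ᾱ⁻¹ A B C ⊙₁ id D) ∘ ᾱ (A ⊙ B) C D
                    ≈ (id A ⊙₁ ᾱ B C D) ∘ ᾱ⁻¹ A B (C ⊙ D)
  ᾱ⁻¹-pentagonˡ =
    conjugate ᾱ-inv₁ ᾱ-inv₂ (≈-trans (≈-sym (move-invˡ (⊙-inverse ᾱ-inv₁ idˡ) P8)) sym-assoc)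

  data Split : Obj S → Obj S → Obj S → Set where
    here : Split (A ⊙ B) A B
    ⊙ˡ   : Split A L R → Split (A ⊙ B) L (R ⊙ B)
    ⊙ʳ   : Split B L R → Split (A ⊙ B) (A ⊙ L) R
    ⊗ˡ   : Split A L R → Split (A ⊗ B) L (R ⊗ B)
    ⊗ʳ   : Split B L R → Split (A ⊗ B) (A ⊗ L) R

  expose : Split X L R → Hom S X (L ⊙ R)
  expose (here {A} {B})          = id (A ⊙ B)
  expose (⊙ˡ {L = L} {R} {B} p)  = ᾱ⁻¹ L R B ∘ (expose p ⊙₁ id B)
  expose (⊙ʳ {L = L} {R} {A} p)  = ᾱ A L R ∘ (id A ⊙₁ expose p)
  expose (⊗ˡ {L = L} {R} {B} p)  = δr L R B ∘ (expose p ⊗₁ id B)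
  expose (⊗ʳ {L = L} {R} {A} p)  = δl A L R ∘ (id A ⊗₁ expose p)

  expose-α-⊗ˡ⊗ˡ : (p : Split A L R) →
    expose (⊗ˡ {B = C} (⊗ˡ {B = B} p)) ∘ α A B C ≈ (id L ⊙₁ α R B C) ∘ expose (⊗ˡ p)
  expose-α-⊗ˡ⊗ˡ {A = A} {L = L} {R = R} {C = C} {B = B} p = begin
    (δr L (R ⊗ B) C ∘ ((δr L R B ∘ (e ⊗₁ id B)) ⊗₁ id C)) ∘ α A B C
      ≈⟨ assoc ⟩
    δr L (R ⊗ B) C ∘ ((δr L R B ∘ (e ⊗₁ id B)) ⊗₁ id C) ∘ α A B C
      ≈⟨ refl⟩∘⟨ pushˡ ∘⊗id ⟩
    δr L (R ⊗ B) C ∘ (δr L R B ⊗₁ id C) ∘ ((e ⊗₁ id B) ⊗₁ id C) ∘ α A B C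
      ≈⟨ refl⟩∘⟨ refl⟩∘⟨ α-nat ⟨
    δr L (R ⊗ B) C ∘ (δr L R B ⊗₁ id C) ∘ α (L ⊙ R) B C ∘ (e ⊗₁ (id B ⊗₁ id C))
      ≈⟨ refl⟩∘⟨ refl⟩∘⟨ refl⟩∘⟨ ⊗-cong ≈-refl ⊗-id ⟩
    δr L (R ⊗ B) C ∘ (δr L R B ⊗₁ id C) ∘ α (L ⊙ R) B C ∘ (e ⊗₁ id (B ⊗ C))
      ≈⟨ extend₂₃ P5 ⟨
    (id L ⊙₁ α R B C) ∘ δr L R (B ⊗ C) ∘ (e ⊗₁ id (B ⊗ C))
      ∎
    where e = expose p

  expose-α-⊗ˡ⊗ʳ : (p : Split B L R) →
    expose (⊗ˡ {B = C} (⊗ʳ {A = A} p)) ∘ α A B C ≈ expose (⊗ʳ {A = A} (⊗ˡ {B = C} p))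
  expose-α-⊗ˡ⊗ʳ {B = B} {L = L} {R = R} {C = C} {A = A} p = begin
    (δr (A ⊗ L) R C ∘ ((δl A L R ∘ (id A ⊗₁ e)) ⊗₁ id C)) ∘ α A B C
      ≈⟨ assoc ⟩
    δr (A ⊗ L) R C ∘ ((δl A L R ∘ (id A ⊗₁ e)) ⊗₁ id C) ∘ α A B C
      ≈⟨ refl⟩∘⟨ pushˡ ∘⊗id ⟩
    δr (A ⊗ L) R C ∘ (δl A L R ⊗₁ id C) ∘ ((id A ⊗₁ e) ⊗₁ id C) ∘ α A B C
      ≈⟨ refl⟩∘⟨ refl⟩∘⟨ α-nat ⟨
    δr (A ⊗ L) R C ∘ (δl A L R ⊗₁ id C) ∘ α A (L ⊙ R) C ∘ (id A ⊗₁ (e ⊗₁ id C))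
      ≈⟨ extend₂₃ P3 ⟨
    δl A L (R ⊗ C) ∘ (id A ⊗₁ δr L R C) ∘ (id A ⊗₁ (e ⊗₁ id C))
      ≈⟨ refl⟩∘⟨ id⊗∘ ⟨
    δl A L (R ⊗ C) ∘ (id A ⊗₁ (δr L R C ∘ (e ⊗₁ id C)))
      ∎
    where e = expose p

  expose-α-⊗ʳ : (p : Split C L R) →
    expose (⊗ʳ {A = A ⊗ B} p) ∘ α A B C ≈ (α A B L ⊙₁ id R) ∘ expose (⊗ʳ {A = A} (⊗ʳ {A = B} p))
  expose-α-⊗ʳ {C = C} {L = L} {R = R} {A = A} {B = B} p = begin
    (δl (A ⊗ B) L R ∘ (id (A ⊗ B) ⊗₁ e)) ∘ α A B C
      ≈⟨ assoc ⟩
    δl (A ⊗ B) L R ∘ (id (A ⊗ B) ⊗₁ e) ∘ α A B C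
      ≈⟨ refl⟩∘⟨ ⊗-cong ⊗-id ≈-refl ⟩∘⟨refl ⟨
    δl (A ⊗ B) L R ∘ ((id A ⊗₁ id B) ⊗₁ e) ∘ α A B C
      ≈⟨ refl⟩∘⟨ α-nat ⟨
    δl (A ⊗ B) L R ∘ α A B (L ⊙ R) ∘ (id A ⊗₁ (id B ⊗₁ e))
      ≈⟨ extend₂₃ P2 ⟩
    (α A B L ⊙₁ id R) ∘ δl A (B ⊗ L) R ∘ (id A ⊗₁ δl B L R) ∘ (id A ⊗₁ (id B ⊗₁ e))
      ≈⟨ refl⟩∘⟨ refl⟩∘⟨ id⊗∘ ⟨
    (α A B L ⊙₁ id R) ∘ δl A (B ⊗ L) R ∘ (id A ⊗₁ (δl B L R ∘ (id B ⊗₁ e)))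
      ∎
    where e = expose p

  expose-ᾱ-⊙ˡhere : expose (⊙ˡ {B = C} (here {A} {B})) ∘ ᾱ A B C ≈ expose (here {A} {B ⊙ C})
  expose-ᾱ-⊙ˡhere {C = C} {A = A} {B = B} = begin
    (ᾱ⁻¹ A B C ∘ (id (A ⊙ B) ⊙₁ id C)) ∘ ᾱ A B C    ≈⟨ assoc ⟩
    ᾱ⁻¹ A B C ∘ (id (A ⊙ B) ⊙₁ id C) ∘ ᾱ A B C      ≈⟨ refl⟩∘⟨ ⊙-id ⟩∘⟨refl ⟩
    ᾱ⁻¹ A B C ∘ id ((A ⊙ B) ⊙ C) ∘ ᾱ A B C         ≈⟨ refl⟩∘⟨ idˡ ⟩
    ᾱ⁻¹ A B C ∘ ᾱ A B C                            ≈⟨ ᾱ-inv₁ ⟩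
    id (A ⊙ (B ⊙ C))                               ∎

  expose-ᾱ-⊙ˡ⊙ˡ : (p : Split A L R) →
    expose (⊙ˡ {B = C} (⊙ˡ {B = B} p)) ∘ ᾱ A B C ≈ (id L ⊙₁ ᾱ R B C) ∘ expose (⊙ˡ p)
  expose-ᾱ-⊙ˡ⊙ˡ {A = A} {L = L} {R = R} {C = C} {B = B} p = begin
    (ᾱ⁻¹ L (R ⊙ B) C ∘ ((ᾱ⁻¹ L R B ∘ (e ⊙₁ id B)) ⊙₁ id C)) ∘ ᾱ A B C
      ≈⟨ assoc ⟩
    ᾱ⁻¹ L (R ⊙ B) C ∘ ((ᾱ⁻¹ L R B ∘ (e ⊙₁ id B)) ⊙₁ id C) ∘ ᾱ A B C
      ≈⟨ refl⟩∘⟨ pushˡ ∘⊙id ⟩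
    ᾱ⁻¹ L (R ⊙ B) C ∘ (ᾱ⁻¹ L R B ⊙₁ id C) ∘ ((e ⊙₁ id B) ⊙₁ id C) ∘ ᾱ A B C
      ≈⟨ refl⟩∘⟨ refl⟩∘⟨ ᾱ-nat ⟨
    ᾱ⁻¹ L (R ⊙ B) C ∘ (ᾱ⁻¹ L R B ⊙₁ id C) ∘ ᾱ (L ⊙ R) B C ∘ (e ⊙₁ (id B ⊙₁ id C))
      ≈⟨ refl⟩∘⟨ refl⟩∘⟨ refl⟩∘⟨ ⊙-cong ≈-refl ⊙-id ⟩
    ᾱ⁻¹ L (R ⊙ B) C ∘ (ᾱ⁻¹ L R B ⊙₁ id C) ∘ ᾱ (L ⊙ R) B C ∘ (e ⊙₁ id (B ⊙ C))
      ≈⟨ extend₃₂ ᾱ⁻¹-pentagonˡ ⟩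
    (id L ⊙₁ ᾱ R B C) ∘ ᾱ⁻¹ L R (B ⊙ C) ∘ (e ⊙₁ id (B ⊙ C))
      ∎
    where e = expose p

  expose-ᾱ-⊙ˡ⊙ʳ : (p : Split B L R) →
    expose (⊙ˡ {B = C} (⊙ʳ {A = A} p)) ∘ ᾱ A B C ≈ expose (⊙ʳ {A = A} (⊙ˡ {B = C} p))
  expose-ᾱ-⊙ˡ⊙ʳ {B = B} {L = L} {R = R} {C = C} {A = A} p = begin
    (ᾱ⁻¹ (A ⊙ L) R C ∘ ((ᾱ A L R ∘ (id A ⊙₁ e)) ⊙₁ id C)) ∘ ᾱ A B C
      ≈⟨ assoc ⟩
    ᾱ⁻¹ (A ⊙ L) R C ∘ ((ᾱ A L R ∘ (id A ⊙₁ e)) ⊙₁ id C) ∘ ᾱ A B C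
      ≈⟨ refl⟩∘⟨ pushˡ ∘⊙id ⟩
    ᾱ⁻¹ (A ⊙ L) R C ∘ (ᾱ A L R ⊙₁ id C) ∘ ((id A ⊙₁ e) ⊙₁ id C) ∘ ᾱ A B C
      ≈⟨ refl⟩∘⟨ refl⟩∘⟨ ᾱ-nat ⟨
    ᾱ⁻¹ (A ⊙ L) R C ∘ (ᾱ A L R ⊙₁ id C) ∘ ᾱ A (L ⊙ R) C ∘ (id A ⊙₁ (e ⊙₁ id C))
      ≈⟨ extend₃₂ (conjugate ᾱ-inv₁ (⊙-inverse idˡ ᾱ-inv₂) (≈-trans P8 sym-assoc)) ⟩
    ᾱ A L (R ⊙ C) ∘ (id A ⊙₁ ᾱ⁻¹ L R C) ∘ (id A ⊙₁ (e ⊙₁ id C))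
      ≈⟨ refl⟩∘⟨ id⊙∘ ⟨
    ᾱ A L (R ⊙ C) ∘ (id A ⊙₁ (ᾱ⁻¹ L R C ∘ (e ⊙₁ id C)))
      ∎
    where e = expose p

  expose-ᾱ-⊙ʳ : (p : Split C L R) →
    expose (⊙ʳ {A = A ⊙ B} p) ∘ ᾱ A B C ≈ (ᾱ A B L ⊙₁ id R) ∘ expose (⊙ʳ {A = A} (⊙ʳ {A = B} p))
  expose-ᾱ-⊙ʳ {C = C} {L = L} {R = R} {A = A} {B = B} p = begin
    (ᾱ (A ⊙ B) L R ∘ (id (A ⊙ B) ⊙₁ e)) ∘ ᾱ A B C
      ≈⟨ assoc ⟩
    ᾱ (A ⊙ B) L R ∘ (id (A ⊙ B) ⊙₁ e) ∘ ᾱ A B C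
      ≈⟨ refl⟩∘⟨ ⊙-cong ⊙-id ≈-refl ⟩∘⟨refl ⟨
    ᾱ (A ⊙ B) L R ∘ ((id A ⊙₁ id B) ⊙₁ e) ∘ ᾱ A B C
      ≈⟨ refl⟩∘⟨ ᾱ-nat ⟨
    ᾱ (A ⊙ B) L R ∘ ᾱ A B (L ⊙ R) ∘ (id A ⊙₁ (id B ⊙₁ e))
      ≈⟨ extend₂₃ P8 ⟩
    (ᾱ A B L ⊙₁ id R) ∘ ᾱ A (B ⊙ L) R ∘ (id A ⊙₁ ᾱ B L R) ∘ (id A ⊙₁ (id B ⊙₁ e))
      ≈⟨ refl⟩∘⟨ refl⟩∘⟨ id⊙∘ ⟨
    (ᾱ A B L ⊙₁ id R) ∘ ᾱ A (B ⊙ L) R ∘ (id A ⊙₁ (ᾱ B L R ∘ (id B ⊙₁ e)))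
      ∎
    where e = expose p

  expose-δl-⊙ˡ⊗ˡ : (p : Split A L R) →
    expose (⊙ˡ {B = C} (⊗ˡ {B = B} p)) ∘ δl A B C ≈ (id L ⊙₁ δl R B C) ∘ expose (⊗ˡ p)
  expose-δl-⊙ˡ⊗ˡ {A = A} {L = L} {R = R} {C = C} {B = B} p = begin
    (ᾱ⁻¹ L (R ⊗ B) C ∘ ((δr L R B ∘ (e ⊗₁ id B)) ⊙₁ id C)) ∘ δl A B C
      ≈⟨ assoc ⟩
    ᾱ⁻¹ L (R ⊗ B) C ∘ ((δr L R B ∘ (e ⊗₁ id B)) ⊙₁ id C) ∘ δl A B C
      ≈⟨ refl⟩∘⟨ pushˡ ∘⊙id ⟩
    ᾱ⁻¹ L (R ⊗ B) C ∘ (δr L R B ⊙₁ id C) ∘ ((e ⊗₁ id B) ⊙₁ id C) ∘ δl A B C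
      ≈⟨ refl⟩∘⟨ refl⟩∘⟨ δl-nat ⟨
    ᾱ⁻¹ L (R ⊗ B) C ∘ (δr L R B ⊙₁ id C) ∘ δl (L ⊙ R) B C ∘ (e ⊗₁ (id B ⊙₁ id C))
      ≈⟨ refl⟩∘⟨ refl⟩∘⟨ refl⟩∘⟨ ⊗-cong ≈-refl ⊙-id ⟩
    ᾱ⁻¹ L (R ⊗ B) C ∘ (δr L R B ⊙₁ id C) ∘ δl (L ⊙ R) B C ∘ (e ⊗₁ id (B ⊙ C))
      ≈⟨ extend₃₂ (move-invˡ ᾱ-inv₁ P6) ⟩
    (id L ⊙₁ δl R B C) ∘ δr L R (B ⊙ C) ∘ (e ⊗₁ id (B ⊙ C))
      ∎
    where e = expose p

  expose-δl-⊙ˡ⊗ʳ : (p : Split B L R) →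
    expose (⊙ˡ {B = C} (⊗ʳ {A = A} p)) ∘ δl A B C ≈ expose (⊗ʳ {A = A} (⊙ˡ {B = C} p))
  expose-δl-⊙ˡ⊗ʳ {B = B} {L = L} {R = R} {C = C} {A = A} p = begin
    (ᾱ⁻¹ (A ⊗ L) R C ∘ ((δl A L R ∘ (id A ⊗₁ e)) ⊙₁ id C)) ∘ δl A B C
      ≈⟨ assoc ⟩
    ᾱ⁻¹ (A ⊗ L) R C ∘ ((δl A L R ∘ (id A ⊗₁ e)) ⊙₁ id C) ∘ δl A B C
      ≈⟨ refl⟩∘⟨ pushˡ ∘⊙id ⟩
    ᾱ⁻¹ (A ⊗ L) R C ∘ (δl A L R ⊙₁ id C) ∘ ((id A ⊗₁ e) ⊙₁ id C) ∘ δl A B C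
      ≈⟨ refl⟩∘⟨ refl⟩∘⟨ δl-nat ⟨
    ᾱ⁻¹ (A ⊗ L) R C ∘ (δl A L R ⊙₁ id C) ∘ δl A (L ⊙ R) C ∘ (id A ⊗₁ (e ⊙₁ id C))
      ≈⟨ extend₃₂ (conjugate ᾱ-inv₁ (⊗-inverse idˡ ᾱ-inv₂) (≈-trans P4 sym-assoc)) ⟩
    δl A L (R ⊙ C) ∘ (id A ⊗₁ ᾱ⁻¹ L R C) ∘ (id A ⊗₁ (e ⊙₁ id C))
      ≈⟨ refl⟩∘⟨ id⊗∘ ⟨
    δl A L (R ⊙ C) ∘ (id A ⊗₁ (ᾱ⁻¹ L R C ∘ (e ⊙₁ id C)))
      ∎
    where e = expose p

  expose-δl-⊙ʳ : (p : Split C L R) →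
    expose (⊙ʳ {A = A ⊗ B} p) ∘ δl A B C ≈ (δl A B L ⊙₁ id R) ∘ expose (⊗ʳ {A = A} (⊙ʳ {A = B} p))
  expose-δl-⊙ʳ {C = C} {L = L} {R = R} {A = A} {B = B} p = begin
    (ᾱ (A ⊗ B) L R ∘ (id (A ⊗ B) ⊙₁ e)) ∘ δl A B C
      ≈⟨ assoc ⟩
    ᾱ (A ⊗ B) L R ∘ (id (A ⊗ B) ⊙₁ e) ∘ δl A B C
      ≈⟨ refl⟩∘⟨ ⊙-cong ⊗-id ≈-refl ⟩∘⟨refl ⟨
    ᾱ (A ⊗ B) L R ∘ ((id A ⊗₁ id B) ⊙₁ e) ∘ δl A B C
      ≈⟨ refl⟩∘⟨ δl-nat ⟨
    ᾱ (A ⊗ B) L R ∘ δl A B (L ⊙ R) ∘ (id A ⊗₁ (id B ⊙₁ e))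
      ≈⟨ extend₂₃ P4 ⟩
    (δl A B L ⊙₁ id R) ∘ δl A (B ⊙ L) R ∘ (id A ⊗₁ ᾱ B L R) ∘ (id A ⊗₁ (id B ⊙₁ e))
      ≈⟨ refl⟩∘⟨ refl⟩∘⟨ id⊗∘ ⟨
    (δl A B L ⊙₁ id R) ∘ δl A (B ⊙ L) R ∘ (id A ⊗₁ (ᾱ B L R ∘ (id B ⊙₁ e)))
      ∎
    where e = expose p

  expose-δr-⊙ˡ : (p : Split A L R) →
    expose (⊙ˡ {B = B ⊗ C} p) ∘ δr A B C ≈ (id L ⊙₁ δr R B C) ∘ expose (⊗ˡ {B = C} (⊙ˡ {B = B} p))
  expose-δr-⊙ˡ {A = A} {L = L} {R = R} {B = B} {C = C} p = begin
    (ᾱ⁻¹ L R (B ⊗ C) ∘ (e ⊙₁ id (B ⊗ C))) ∘ δr A B C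
      ≈⟨ assoc ⟩
    ᾱ⁻¹ L R (B ⊗ C) ∘ (e ⊙₁ id (B ⊗ C)) ∘ δr A B C
      ≈⟨ refl⟩∘⟨ ⊙-cong ≈-refl ⊗-id ⟩∘⟨refl ⟨
    ᾱ⁻¹ L R (B ⊗ C) ∘ (e ⊙₁ (id B ⊗₁ id C)) ∘ δr A B C
      ≈⟨ refl⟩∘⟨ δr-nat ⟨
    ᾱ⁻¹ L R (B ⊗ C) ∘ δr (L ⊙ R) B C ∘ ((e ⊙₁ id B) ⊗₁ id C)
      ≈⟨ extend₂₃ (≈-trans (conjugate ᾱ-inv₁ (⊗-inverse ᾱ-inv₂ idˡ) (≈-sym P7)) assoc) ⟩
    (id L ⊙₁ δr R B C) ∘ δr L (R ⊙ B) C ∘ (ᾱ⁻¹ L R B ⊗₁ id C) ∘ ((e ⊙₁ id B) ⊗₁ id C)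
      ≈⟨ refl⟩∘⟨ refl⟩∘⟨ ∘⊗id ⟨
    (id L ⊙₁ δr R B C) ∘ δr L (R ⊙ B) C ∘ ((ᾱ⁻¹ L R B ∘ (e ⊙₁ id B)) ⊗₁ id C)
      ∎
    where e = expose p

  expose-δr-⊙ʳ⊗ˡ : (p : Split B L R) →
    expose (⊙ʳ {A = A} (⊗ˡ {B = C} p)) ∘ δr A B C ≈ expose (⊗ˡ {B = C} (⊙ʳ {A = A} p))
  expose-δr-⊙ʳ⊗ˡ {B = B} {L = L} {R = R} {A = A} {C = C} p = begin
    (ᾱ A L (R ⊗ C) ∘ (id A ⊙₁ (δr L R C ∘ (e ⊗₁ id C)))) ∘ δr A B C
      ≈⟨ assoc ⟩
    ᾱ A L (R ⊗ C) ∘ (id A ⊙₁ (δr L R C ∘ (e ⊗₁ id C))) ∘ δr A B C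
      ≈⟨ refl⟩∘⟨ pushˡ id⊙∘ ⟩
    ᾱ A L (R ⊗ C) ∘ (id A ⊙₁ δr L R C) ∘ (id A ⊙₁ (e ⊗₁ id C)) ∘ δr A B C
      ≈⟨ refl⟩∘⟨ refl⟩∘⟨ δr-nat ⟨
    ᾱ A L (R ⊗ C) ∘ (id A ⊙₁ δr L R C) ∘ δr A (L ⊙ R) C ∘ ((id A ⊙₁ e) ⊗₁ id C)
      ≈⟨ extend₂₃ P7 ⟨
    δr (A ⊙ L) R C ∘ (ᾱ A L R ⊗₁ id C) ∘ ((id A ⊙₁ e) ⊗₁ id C)
      ≈⟨ refl⟩∘⟨ ∘⊗id ⟨
    δr (A ⊙ L) R C ∘ ((ᾱ A L R ∘ (id A ⊙₁ e)) ⊗₁ id C)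
      ∎
    where e = expose p

  expose-δr-⊙ʳ⊗ʳ : (p : Split C L R) →
    expose (⊙ʳ {A = A} (⊗ʳ {A = B} p)) ∘ δr A B C ≈ (δr A B L ⊙₁ id R) ∘ expose (⊗ʳ {A = A ⊙ B} p)
  expose-δr-⊙ʳ⊗ʳ {C = C} {L = L} {R = R} {A = A} {B = B} p = begin
    (ᾱ A (B ⊗ L) R ∘ (id A ⊙₁ (δl B L R ∘ (id B ⊗₁ e)))) ∘ δr A B C
      ≈⟨ assoc ⟩
    ᾱ A (B ⊗ L) R ∘ (id A ⊙₁ (δl B L R ∘ (id B ⊗₁ e))) ∘ δr A B C
      ≈⟨ refl⟩∘⟨ pushˡ id⊙∘ ⟩
    ᾱ A (B ⊗ L) R ∘ (id A ⊙₁ δl B L R) ∘ (id A ⊙₁ (id B ⊗₁ e)) ∘ δr A B C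
      ≈⟨ refl⟩∘⟨ refl⟩∘⟨ δr-nat ⟨
    ᾱ A (B ⊗ L) R ∘ (id A ⊙₁ δl B L R) ∘ δr A B (L ⊙ R) ∘ ((id A ⊙₁ id B) ⊗₁ e)
      ≈⟨ extend₂₃ P6 ⟨
    (δr A B L ⊙₁ id R) ∘ δl (A ⊙ B) L R ∘ ((id A ⊙₁ id B) ⊗₁ e)
      ≈⟨ refl⟩∘⟨ refl⟩∘⟨ ⊗-cong ⊙-id ≈-refl ⟩
    (δr A B L ⊙₁ id R) ∘ δl (A ⊙ B) L R ∘ (id (A ⊙ B) ⊗₁ e)
      ∎
    where e = expose p

  record Factorisation (f : Hom S X Z) (p : Split Z L R) : Set where
    constructor factorisation
    field
      {L₀ R₀}  : Obj S
      split    : Split X L₀ R₀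
      left     : Hom S L₀ L
      right    : Hom S R₀ R
      commutes : expose p ∘ f ≈ (left ⊙₁ right) ∘ expose split

  open Factorisation

  identity-factorisation : {f : Hom S X Z} {p : Split Z L R} (q : Split X L R) →
                           expose p ∘ f ≈ expose q → Factorisation f p
  identity-factorisation {L = L} {R = R} q commutes =
    factorisation q (id L) (id R) (≈-trans commutes (≈-sym (≈-trans (⊙-id ⟩∘⟨refl) idˡ)))

  invert : {f : Hom S X Z} {f⁻¹ : Hom S Z X} {p : Split Z L R} (F : Factorisation f p) →
           {left⁻¹ : Hom S L (L₀ F)} {right⁻¹ : Hom S R (R₀ F)} →
           left⁻¹ ∘ left F ≈ id (L₀ F) → right⁻¹ ∘ right F ≈ id (R₀ F) → f ∘ f⁻¹ ≈ id Z →
           Factorisation f⁻¹ (split F)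
  invert {p = p} (factorisation q l r commutes) l⁻¹l≈id r⁻¹r≈id ff⁻¹≈id =
    factorisation p _ _ (≈-sym (conjugate (⊙-inverse l⁻¹l≈id r⁻¹r≈id) ff⁻¹≈id (≈-sym commutes)))

  infixr 9 _∘ᶠ_
  _∘ᶠ_ : {f : Hom S Y Z} {g : Hom S X Y} {p : Split Z L R} (F : Factorisation f p) →
         Factorisation g (split F) → Factorisation (f ∘ g) p
  _∘ᶠ_ {f = f} {g} {p} (factorisation q l r f-commutes) (factorisation q₀ l₀ r₀ g-commutes) =
    factorisation q₀ (l ∘ l₀) (r ∘ r₀) (begin
      expose p ∘ f ∘ g                     ≈⟨ pullˡ f-commutes ⟩
      ((l ⊙₁ r) ∘ expose q) ∘ g             ≈⟨ assoc ⟩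
      (l ⊙₁ r) ∘ expose q ∘ g               ≈⟨ refl⟩∘⟨ g-commutes ⟩
      (l ⊙₁ r) ∘ (l₀ ⊙₁ r₀) ∘ expose q₀     ≈⟨ pullˡ (≈-sym ⊙-∘) ⟩
      ((l ∘ l₀) ⊙₁ (r ∘ r₀)) ∘ expose q₀    ∎)

  ⊗ˡ-factorisation : {f : Hom S A A'} {p : Split A' L R} (g : Hom S B B') →
                     Factorisation f p → Factorisation (f ⊗₁ g) (⊗ˡ p)
  ⊗ˡ-factorisation {A = A} {L = L} {R = R} {B = B} {B'} {f} {p} g (factorisation {L₀} {R₀} q l r commutes) =
    factorisation (⊗ˡ q) l (r ⊗₁ g) (begin
      (δr L R B' ∘ (e ⊗₁ id B')) ∘ (f ⊗₁ g)        ≈⟨ assoc ⟩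
      δr L R B' ∘ (e ⊗₁ id B') ∘ (f ⊗₁ g)          ≈⟨ refl⟩∘⟨ ⊗-∘ ⟨
      δr L R B' ∘ ((e ∘ f) ⊗₁ (id B' ∘ g))          ≈⟨ refl⟩∘⟨ ⊗-cong commutes (id-slide ≈-refl) ⟩
      δr L R B' ∘ (((l ⊙₁ r) ∘ e₀) ⊗₁ (g ∘ id B))   ≈⟨ refl⟩∘⟨ ⊗-∘ ⟩
      δr L R B' ∘ ((l ⊙₁ r) ⊗₁ g) ∘ (e₀ ⊗₁ id B)    ≈⟨ extendʳ δr-nat ⟩
      (l ⊙₁ (r ⊗₁ g)) ∘ δr L₀ R₀ B ∘ (e₀ ⊗₁ id B)   ∎)
    where e = expose p; e₀ = expose q

  ⊗ʳ-factorisation : {g : Hom S B B'} {p : Split B' L R} (f : Hom S A A') →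
                     Factorisation g p → Factorisation (f ⊗₁ g) (⊗ʳ p)
  ⊗ʳ-factorisation {B = B} {L = L} {R = R} {A = A} {A'} {g} {p} f (factorisation {L₀} {R₀} q l r commutes) =
    factorisation (⊗ʳ q) (f ⊗₁ l) r (begin
      (δl A' L R ∘ (id A' ⊗₁ e)) ∘ (f ⊗₁ g)        ≈⟨ assoc ⟩
      δl A' L R ∘ (id A' ⊗₁ e) ∘ (f ⊗₁ g)          ≈⟨ refl⟩∘⟨ ⊗-∘ ⟨
      δl A' L R ∘ ((id A' ∘ f) ⊗₁ (e ∘ g))          ≈⟨ refl⟩∘⟨ ⊗-cong (id-slide ≈-refl) commutes ⟩
      δl A' L R ∘ ((f ∘ id A) ⊗₁ ((l ⊙₁ r) ∘ e₀))   ≈⟨ refl⟩∘⟨ ⊗-∘ ⟩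
      δl A' L R ∘ (f ⊗₁ (l ⊙₁ r)) ∘ (id A ⊗₁ e₀)    ≈⟨ extendʳ δl-nat ⟩
      ((f ⊗₁ l) ⊙₁ r) ∘ δl A L₀ R₀ ∘ (id A ⊗₁ e₀)   ∎)
    where e = expose p; e₀ = expose q

  ⊙ˡ-factorisation : {f : Hom S A A'} {p : Split A' L R} (g : Hom S B B') →
                     Factorisation f p → Factorisation (f ⊙₁ g) (⊙ˡ p)
  ⊙ˡ-factorisation {A = A} {L = L} {R = R} {B = B} {B'} {f} {p} g (factorisation {L₀} {R₀} q l r commutes) =
    factorisation (⊙ˡ q) l (r ⊙₁ g) (begin
      (ᾱ⁻¹ L R B' ∘ (e ⊙₁ id B')) ∘ (f ⊙₁ g)        ≈⟨ assoc ⟩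
      ᾱ⁻¹ L R B' ∘ (e ⊙₁ id B') ∘ (f ⊙₁ g)          ≈⟨ refl⟩∘⟨ ⊙-∘ ⟨
      ᾱ⁻¹ L R B' ∘ ((e ∘ f) ⊙₁ (id B' ∘ g))          ≈⟨ refl⟩∘⟨ ⊙-cong commutes (id-slide ≈-refl) ⟩
      ᾱ⁻¹ L R B' ∘ (((l ⊙₁ r) ∘ e₀) ⊙₁ (g ∘ id B))   ≈⟨ refl⟩∘⟨ ⊙-∘ ⟩
      ᾱ⁻¹ L R B' ∘ ((l ⊙₁ r) ⊙₁ g) ∘ (e₀ ⊙₁ id B)    ≈⟨ extendʳ ᾱ⁻¹-nat ⟩
      (l ⊙₁ (r ⊙₁ g)) ∘ ᾱ⁻¹ L₀ R₀ B ∘ (e₀ ⊙₁ id B)   ∎)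
    where e = expose p; e₀ = expose q

  ⊙ʳ-factorisation : {g : Hom S B B'} {p : Split B' L R} (f : Hom S A A') →
                     Factorisation g p → Factorisation (f ⊙₁ g) (⊙ʳ p)
  ⊙ʳ-factorisation {B = B} {L = L} {R = R} {A = A} {A'} {g} {p} f (factorisation {L₀} {R₀} q l r commutes) =
    factorisation (⊙ʳ q) (f ⊙₁ l) r (begin
      (ᾱ A' L R ∘ (id A' ⊙₁ e)) ∘ (f ⊙₁ g)        ≈⟨ assoc ⟩
      ᾱ A' L R ∘ (id A' ⊙₁ e) ∘ (f ⊙₁ g)          ≈⟨ refl⟩∘⟨ ⊙-∘ ⟨
      ᾱ A' L R ∘ ((id A' ∘ f) ⊙₁ (e ∘ g))          ≈⟨ refl⟩∘⟨ ⊙-cong (id-slide ≈-refl) commutes ⟩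
      ᾱ A' L R ∘ ((f ∘ id A) ⊙₁ ((l ⊙₁ r) ∘ e₀))   ≈⟨ refl⟩∘⟨ ⊙-∘ ⟩
      ᾱ A' L R ∘ (f ⊙₁ (l ⊙₁ r)) ∘ (id A ⊙₁ e₀)    ≈⟨ extendʳ ᾱ-nat ⟩
      ((f ⊙₁ l) ⊙₁ r) ∘ ᾱ A L₀ R₀ ∘ (id A ⊙₁ e₀)   ∎)
    where e = expose p; e₀ = expose q

  factorise-α : (p : Split ((A ⊗ B) ⊗ C) L R) → Factorisation (α A B C) p
  factorise-α (⊗ˡ (⊗ˡ p)) = factorisation (⊗ˡ p) (id _) (α _ _ _) (expose-α-⊗ˡ⊗ˡ p)
  factorise-α (⊗ˡ (⊗ʳ p)) = identity-factorisation (⊗ʳ (⊗ˡ p)) (expose-α-⊗ˡ⊗ʳ p)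
  factorise-α (⊗ʳ p)      = factorisation (⊗ʳ (⊗ʳ p)) (α _ _ _) (id _) (expose-α-⊗ʳ p)

  factorise-ᾱ : (p : Split ((A ⊙ B) ⊙ C) L R) → Factorisation (ᾱ A B C) p
  factorise-ᾱ here        = identity-factorisation (⊙ʳ here) (id-slide ⊙-id)
  factorise-ᾱ (⊙ˡ here)   = identity-factorisation here expose-ᾱ-⊙ˡhere
  factorise-ᾱ (⊙ˡ (⊙ˡ p)) = factorisation (⊙ˡ p) (id _) (ᾱ _ _ _) (expose-ᾱ-⊙ˡ⊙ˡ p)
  factorise-ᾱ (⊙ˡ (⊙ʳ p)) = identity-factorisation (⊙ʳ (⊙ˡ p)) (expose-ᾱ-⊙ˡ⊙ʳ p)
  factorise-ᾱ (⊙ʳ p)      = factorisation (⊙ʳ (⊙ʳ p)) (ᾱ _ _ _) (id _) (expose-ᾱ-⊙ʳ p)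

  factorise-δl : (p : Split ((A ⊗ B) ⊙ C) L R) → Factorisation (δl A B C) p
  factorise-δl here        = identity-factorisation (⊗ʳ here) (id-slide ⊗-id)
  factorise-δl (⊙ˡ (⊗ˡ p)) = factorisation (⊗ˡ p) (id _) (δl _ _ _) (expose-δl-⊙ˡ⊗ˡ p)
  factorise-δl (⊙ˡ (⊗ʳ p)) = identity-factorisation (⊗ʳ (⊙ˡ p)) (expose-δl-⊙ˡ⊗ʳ p)
  factorise-δl (⊙ʳ p)      = factorisation (⊗ʳ (⊙ʳ p)) (δl _ _ _) (id _) (expose-δl-⊙ʳ p)

  factorise-δr : (p : Split (A ⊙ (B ⊗ C)) L R) → Factorisation (δr A B C) p
  factorise-δr here        = identity-factorisation (⊗ˡ here) (id-slide ⊗-id)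
  factorise-δr (⊙ˡ p)      = factorisation (⊗ˡ (⊙ˡ p)) (id _) (δr _ _ _) (expose-δr-⊙ˡ p)
  factorise-δr (⊙ʳ (⊗ˡ p)) = identity-factorisation (⊗ˡ (⊙ʳ p)) (expose-δr-⊙ʳ⊗ˡ p)
  factorise-δr (⊙ʳ (⊗ʳ p)) = factorisation (⊗ʳ p) (δr _ _ _) (id _) (expose-δr-⊙ʳ⊗ʳ p)

  factorise : (f : Hom S X Z) (p : Split Z L R) → Factorisation f p
  factorise (id _)      p      = identity-factorisation p idʳ
  factorise (f ∘ g)     p      = let F = factorise f p in F ∘ᶠ factorise g (split F)
  factorise (f ⊗₁ g)    (⊗ˡ p) = ⊗ˡ-factorisation g (factorise f p)
  factorise (f ⊗₁ g)    (⊗ʳ p) = ⊗ʳ-factorisation f (factorise g p)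
  factorise (f ⊙₁ g)    here   = factorisation here f g (id-slide ≈-refl)
  factorise (f ⊙₁ g)    (⊙ˡ p) = ⊙ˡ-factorisation g (factorise f p)
  factorise (f ⊙₁ g)    (⊙ʳ p) = ⊙ʳ-factorisation f (factorise g p)
  factorise (α _ _ _)   p      = factorise-α p
  factorise (ᾱ _ _ _)   p      = factorise-ᾱ p
  factorise (δl _ _ _)  p      = factorise-δl p
  factorise (δr _ _ _)  p      = factorise-δr p
  factorise (α⁻¹ _ _ _) (⊗ˡ p)       = invert (factorise-α (⊗ˡ (⊗ˡ p))) idˡ α-inv₁ α-inv₂
  factorise (α⁻¹ _ _ _) (⊗ʳ (⊗ˡ p))  = invert (factorise-α (⊗ˡ (⊗ʳ p))) idˡ idˡ α-inv₂
  factorise (α⁻¹ _ _ _) (⊗ʳ (⊗ʳ p))  = invert (factorise-α (⊗ʳ p)) α-inv₁ idˡ α-inv₂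
  factorise (ᾱ⁻¹ _ _ _) here         = invert (factorise-ᾱ (⊙ˡ here)) idˡ idˡ ᾱ-inv₂
  factorise (ᾱ⁻¹ _ _ _) (⊙ˡ p)       = invert (factorise-ᾱ (⊙ˡ (⊙ˡ p))) idˡ ᾱ-inv₁ ᾱ-inv₂
  factorise (ᾱ⁻¹ _ _ _) (⊙ʳ here)    = invert (factorise-ᾱ here) idˡ idˡ ᾱ-inv₂
  factorise (ᾱ⁻¹ _ _ _) (⊙ʳ (⊙ˡ p))  = invert (factorise-ᾱ (⊙ˡ (⊙ʳ p))) idˡ idˡ ᾱ-inv₂
  factorise (ᾱ⁻¹ _ _ _) (⊙ʳ (⊙ʳ p))  = invert (factorise-ᾱ (⊙ʳ p)) ᾱ-inv₁ idˡ ᾱ-inv₂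

  size : Obj S → ℕ
  size (var _) = 1
  size (A ⊗ B) = size A + size B
  size (A ⊙ B) = size A + size B

  size-invariant : Hom S X Y → size X ≡ size Y
  size-invariant (id _)      = refl
  size-invariant (f ∘ g)     = ≡.trans (size-invariant g) (size-invariant f)
  size-invariant (f ⊗₁ g)    = cong₂ _+_ (size-invariant f) (size-invariant g)
  size-invariant (f ⊙₁ g)    = cong₂ _+_ (size-invariant f) (size-invariant g)
  size-invariant (α A B C)   = ≡.sym (+-assoc (size A) (size B) (size C))
  size-invariant (α⁻¹ A B C) = +-assoc (size A) (size B) (size C)
  size-invariant (ᾱ A B C)   = ≡.sym (+-assoc (size A) (size B) (size C))
  size-invariant (ᾱ⁻¹ A B C) = +-assoc (size A) (size B) (size C)
  size-invariant (δl A B C)  = ≡.sym (+-assoc (size A) (size B) (size C))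
  size-invariant (δr A B C)  = +-assoc (size A) (size B) (size C)

  0<size : ∀ X → 0 < size X
  0<size (var _) = z<s
  0<size (A ⊗ B) = <-≤-trans (0<size A) (m≤m+n _ _)
  0<size (A ⊙ B) = <-≤-trans (0<size A) (m≤m+n _ _)

  size<size+size : ∀ A B → size A < size A + size B
  size<size+size A B = m<m+n (size A) (0<size B)

  size-left< : Split X L R → size L < size X
  size-left< (here {A} {B})  = size<size+size A B
  size-left< (⊙ˡ p)          = <-≤-trans (size-left< p) (m≤m+n _ _)
  size-left< (⊙ʳ {A = A} p)  = +-monoʳ-< (size A) (size-left< p)
  size-left< (⊗ˡ p)          = <-≤-trans (size-left< p) (m≤m+n _ _)
  size-left< (⊗ʳ {A = A} p)  = +-monoʳ-< (size A) (size-left< p)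

  SomeSplit : Obj S → Set
  SomeSplit X = Σ[ L ∈ Obj S ] Σ[ R ∈ Obj S ] Split X L R

  left-size-determines-split : (p : Split X L R) (q : Split X L' R') → size L ≡ size L' →
                               _≡_ {A = SomeSplit X} (L , R , p) (L' , R' , q)
  left-size-determines-split here here _ = refl
  left-size-determines-split here (⊙ˡ q) eq = ⊥-elim (>⇒≢ (size-left< q) eq)
  left-size-determines-split (here {A}) (⊙ʳ {L = L'} q) eq = ⊥-elim (<⇒≢ (size<size+size A L') eq)
  left-size-determines-split (⊙ˡ p) here eq = ⊥-elim (<⇒≢ (size-left< p) eq)
  left-size-determines-split (⊙ˡ p) (⊙ˡ q) eq with left-size-determines-split p q eq
  ... | refl = refl
  left-size-determines-split (⊙ˡ p) (⊙ʳ {L = L'} {A = A} q) eq =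
    ⊥-elim (<⇒≢ (<-trans (size-left< p) (size<size+size A L')) eq)
  left-size-determines-split (⊙ʳ {L = L} {A = A} p) here eq = ⊥-elim (>⇒≢ (size<size+size A L) eq)
  left-size-determines-split (⊙ʳ {L = L} {A = A} p) (⊙ˡ q) eq =
    ⊥-elim (>⇒≢ (<-trans (size-left< q) (size<size+size A L)) eq)
  left-size-determines-split (⊙ʳ {A = A} p) (⊙ʳ q) eq
    with left-size-determines-split p q (+-cancelˡ-≡ (size A) _ _ eq)
  ... | refl = refl
  left-size-determines-split (⊗ˡ p) (⊗ˡ q) eq with left-size-determines-split p q eq
  ... | refl = refl
  left-size-determines-split (⊗ˡ p) (⊗ʳ {L = L'} {A = A} q) eq =
    ⊥-elim (<⇒≢ (<-trans (size-left< p) (size<size+size A L')) eq)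
  left-size-determines-split (⊗ʳ {L = L} {A = A} p) (⊗ˡ q) eq =
    ⊥-elim (>⇒≢ (<-trans (size-left< q) (size<size+size A L)) eq)
  left-size-determines-split (⊗ʳ {A = A} p) (⊗ʳ q) eq
    with left-size-determines-split p q (+-cancelˡ-≡ (size A) _ _ eq)
  ... | refl = refl

  ⊙-thin : {Y' Y'' : Obj S} → Thin S Y' → Thin S Y'' → Thin S (Y' ⊙ Y'')
  ⊙-thin thin' thin'' X f g with factorise f here | factorise g here
  ... | factorisation p f' f'' f-commutes | factorisation q g' g'' g-commutes
    with left-size-determines-split p q (≡.trans (size-invariant f') (≡.sym (size-invariant g')))
  ... | refl = begin
    f                          ≈⟨ idˡ ⟨
    id _ ∘ f                   ≈⟨ f-commutes ⟩
    (f' ⊙₁ f'') ∘ expose p     ≈⟨ ⊙-cong (thin' _ f' g') (thin'' _ f'' g'') ⟩∘⟨refl ⟩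
    (g' ⊙₁ g'') ∘ expose p     ≈⟨ g-commutes ⟨
    id _ ∘ g                   ≈⟨ idˡ ⟩
    g                          ∎

lemma5p6 : (S : Set) (Y' Y'' : Obj S) →
    Thin S Y' → Thin S Y'' → Thin S (_⊙_ {S} Y' Y'')
lemma5p6 S Y' Y'' = FreeLDCategory.⊙-thin S
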